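{- Let $n\ge5$, $q\ge1$, $B_{i,j}^{(k)}=\{(\sigma_1,\dots,\sigma_q)\in A_n^q: i^{\sigma_k}=j\}$, $\mathcal{B}=\{B_{i,j}^{(k)}: i,j\in\{1,\dots,n\},k\in\{1,\dots,q\}\}$, and for $k=1,\dots,q$ let $\mathcal{R}_i^{(k)}=\{B_{i,1}^{(k)},\dots,B_{i,n}^{(k)}\}$ and $\mathcal{C}_j^{(k)}=\{B_{1,j}^{(k)},\dots,B_{n,j}^{(k)}\}$. Then for any $x_1,\dots,x_n\in\mathcal{B}$, $x_1\cup x_2\cup\cdots\cup x_n=A_n^q$ if and only if there exist $k\in\{1,\dots,q\}$ and $i$ or $j$ in $\{1,\dots,n\}$ such that $\{x_1,\dots,x_n\}=\mathcal{R}_i^{(k)}$ or $\{x_1,\dots,x_n\}=\mathcal{C}_j^{(k)}$.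
   Context: $X=\{1,\dots,n\}$; permutations act on the right, $i^\sigma$ the image of $i$; $A_n$ is the alternating group on $X$ and $A_n^q$ its $q$-fold direct product. -}

module Defs where

open import Level using (0ℓ)
open import Data.Nat using (ℕ; _%_)
open import Data.Fin using (Fin; _<_; _<?_)
open import Data.Fin.Permutation using (Permutation′; _⟨$⟩ʳ_)
open import Data.List using (List; length; filter; concatMap; map; allFin)
open import Data.Product using (Σ; _×_; _,_; proj₁; ∃; ∃-syntax)
open import Relation.Nullary.Decidable using (_×-dec_)
open import Relation.Binary.PropositionalEquality using (_≡_)
open import Relation.Unary using (Pred; _≐_)

pairs : (n : ℕ) → List (Fin n × Fin n)
pairs n = concatMap (λ a → map (a ,_) (allFin n)) (allFin n)

inversions : {n : ℕ} → Permutation′ n → ℕ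
inversions {n} σ =
  length (filter (λ p → (proj₁ p <? Data.Product.proj₂ p)
                        ×-dec ((σ ⟨$⟩ʳ Data.Product.proj₂ p) <? (σ ⟨$⟩ʳ proj₁ p)))
                 (pairs n))

IsEven : {n : ℕ} → Permutation′ n → Set
IsEven σ = inversions σ % 2 ≡ 0

Alt : ℕ → Set
Alt n = Σ (Permutation′ n) IsEven

AltPow : ℕ → ℕ → Set
AltPow n q = Fin q → Alt n

B : {n q : ℕ} → Fin q → Fin n → Fin n → Pred (AltPow n q) 0ℓ
B k i j g = proj₁ (g k) ⟨$⟩ʳ i ≡ j

In𝓑 : {n q : ℕ} → Pred (AltPow n q) 0ℓ → Set
In𝓑 {n} {q} x = ∃[ k ] ∃[ i ] ∃[ j ] (x ≐ B {n} {q} k i j)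

CoversAll : {n q : ℕ} → (Fin n → Pred (AltPow n q) 0ℓ) → Set
CoversAll {n} {q} x = (g : AltPow n q) → ∃[ t ] x t g

-- equality of sets of subsets: {x_1,…,x_n} = {y_1,…,y_n}
-- (subsets compared extensionally)
SameFamily : {n q : ℕ} → (Fin n → Pred (AltPow n q) 0ℓ) → (Fin n → Pred (AltPow n q) 0ℓ) → Set
SameFamily {n} x y = ((t : Fin n) → ∃[ s ] (x t ≐ y s)) × ((s : Fin n) → ∃[ t ] (x t ≐ y s))

Row : {n q : ℕ} → Fin q → Fin n → Fin n → Pred (AltPow n q) 0ℓ
Row k i j = B k i j

Col : {n q : ℕ} → Fin q → Fin n → Fin n → Pred (AltPow n q) 0ℓ
Col k j i = B k i j

module Submission where

-- Members are read as cells (i , j) of the n × n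
-- board in coordinate k; a tuple (σ_k) escapes the union iff each σ_k
-- avoids the cells in its coordinate (i^{σ_k} ≠ j).  Lines cover, as every
-- σ maps i somewhere.  Conversely the proof constructs escaping tuples of
-- even permutations from three general facts:
--   1. parity (the inversion count mod 2) is a homomorphism to (Bool , xor),
--      hence inserting a pair i ↦ j shifts parity by a constant;
--   2. (avoidance) for m ≥ 3, fewer than m cells are avoided by permutations
--      of both parities — induction on m by inserting i ↦ j for an empty row i;
--   3. a "sparse" family of n cells (no empty cell sees two members in its
--      row and column) is a full row or column.
-- If the members use two coordinates, each coordinate has fewer than n
-- cells (fact 2); otherwise a clash against sparseness gives a minor with
-- fewer than n - 1 cells (facts 1 and 2), and sparse families are lines (fact 3).

open import Level using (0ℓ)
open import Data.Bool using (Bool; true; false; not; _∧_; _xor_)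
open import Data.Bool.Properties
  using (xor-∧-commutativeRing; xor-assoc; xor-comm; xor-same; xor-identityʳ;
         ∧-distribˡ-xor; ∧-zeroʳ; ∧-comm; not-involutive)
open import Data.Nat using (ℕ; zero; suc; _+_; _%_; _≤_; _<_; z≤n; s≤s)
open import Data.Nat.Properties
  using (≮⇒≥; +-comm; ≤-trans; ≤-refl; ≤-reflexive; ≤-pred; n≤1+n; n<1+n)
open import Data.Nat.DivMod using ([m+n]%n≡m%n)
open import Data.Fin using (Fin; zero; suc; _<?_; punchIn; punchOut)
open import Data.Fin.Properties
  using (_≟_; <-irrefl; <-asym; ≤-antisym; all?; any?; ¬∀⟶∃¬; <⇒notInjective; 0≢1+n;
         punchIn-punchOut; punchInᵢ≢i; punchIn-injective)
open import Data.Fin.Permutation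
  using (Permutation′; _⟨$⟩ʳ_; _⟨$⟩ˡ_; _∘ₚ_; id; transpose; lift₀; insert;
         inverseˡ; inverseʳ; insert-punchIn)
open import Data.List
  using (List; []; _∷_; _++_; length; filter; concatMap; map; foldr; tabulate; allFin; lookup)
open import Data.List.Properties using (length-map; length-tabulate; filter-notAll)
open import Data.List.Membership.Propositional.Properties using (∈-filter⁺; ∈-allFin)
open import Data.List.Relation.Unary.All as All using (All; []; _∷_)
import Data.List.Relation.Unary.All.Properties as AllP
open import Data.List.Relation.Unary.All.Properties.Core using (¬Any⇒All¬)
import Data.List.Relation.Unary.Any as Any
import Data.List.Relation.Unary.Any.Properties as AnyP
open import Data.Product using (_×_; _,_; proj₁; proj₂; ∃-syntax)
open import Data.Sum as Sum using (_⊎_; inj₁; inj₂)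
open import Data.Empty using (⊥-elim)
open import Data.Unit using (tt)
open import Function.Bundles using (_⇔_; mk⇔)
open import Relation.Binary.PropositionalEquality
open import Relation.Nullary using (Dec; does; yes; no; ¬_; ¬?; _×-dec_; _⊎-dec_)
open import Relation.Nullary.Decidable using (dec-true; dec-false; toWitness)
open import Relation.Unary using (Pred; Decidable; _≐_)
open import Algebra.Bundles using (CommutativeRing)
import Algebra.Properties.CommutativeMonoid.Sum as MonoidSum
open import Defs

open MonoidSum (CommutativeRing.+-commutativeMonoid xor-∧-commutativeRing)
  using (sum; sum-cong-≗; sum-replicate-zero; ∑-distrib-+; ∑-permute)

private
  variable
    n : ℕ

∑∑ : (Fin n → Fin n → Bool) → Bool
∑∑ f = sum (λ p → sum (f p))

∑∑-cong : {f g : Fin n → Fin n → Bool} → (∀ p q → f p q ≡ g p q) → ∑∑ f ≡ ∑∑ g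
∑∑-cong f≗g = sum-cong-≗ (λ p → sum-cong-≗ (f≗g p))

∑∑-xor : (f g : Fin n → Fin n → Bool) →
  ∑∑ (λ p q → f p q xor g p q) ≡ ∑∑ f xor ∑∑ g
∑∑-xor f g = trans (sum-cong-≗ (λ p → ∑-distrib-+ (f p) (g p)))
                   (∑-distrib-+ (λ p → sum (f p)) (λ p → sum (g p)))

∑∑-permute : (f : Fin n → Fin n → Bool) (π : Permutation′ n) →
  ∑∑ f ≡ ∑∑ (λ p q → f (π ⟨$⟩ʳ p) (π ⟨$⟩ʳ q))
∑∑-permute f π = trans (∑-permute (λ p → sum (f p)) π)
                       (sum-cong-≗ (λ p → ∑-permute (f (π ⟨$⟩ʳ p)) π))

Symmetric : (Fin n → Fin n → Bool) → Set
Symmetric f = ∀ p q → f p q ≡ f q p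

-- Over GF(2), a symmetric matrix with zero diagonal has total sum zero:
-- the entries (p , q) and (q , p) cancel.
∑∑-symmetric : (f : Fin n → Fin n → Bool) → Symmetric f → (∀ p → f p p ≡ false) →
  ∑∑ f ≡ false
∑∑-symmetric {zero}  f sym-f diag = refl
∑∑-symmetric {suc n} f sym-f diag =
  begin
    (f zero zero xor row) xor sum (λ p → f (suc p) zero xor sum (λ q → f (suc p) (suc q)))
  ≡⟨ cong₂ (λ d s → (d xor row) xor s) (diag zero)
           (∑-distrib-+ (λ p → f (suc p) zero) (λ p → sum (λ q → f (suc p) (suc q)))) ⟩
    row xor (sum (λ p → f (suc p) zero) xor ∑∑ (λ p q → f (suc p) (suc q)))
  ≡⟨ cong₂ (λ c s → row xor (c xor s)) (sum-cong-≗ (λ p → sym-f (suc p) zero))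
           (∑∑-symmetric (λ p q → f (suc p) (suc q)) (λ p q → sym-f (suc p) (suc q)) (λ p → diag (suc p))) ⟩
    row xor (row xor false)
  ≡⟨ trans (sym (xor-assoc row row false)) (cong (_xor false) (xor-same row)) ⟩
    false
  ∎
  where
  open ≡-Reasoning
  row : Bool
  row = sum (λ q → f zero (suc q))

lt : Fin n → Fin n → Bool
lt a b = does (a <? b)

lt-irrefl : (a : Fin n) → lt a a ≡ false
lt-irrefl a = dec-false (a <? a) (<-irrefl refl)

lt-flip : {a b : Fin n} → a ≢ b → lt b a ≡ not (lt a b)
lt-flip {a = a} {b} a≢b with a <? b | b <? a
... | yes a<b | yes b<a = ⊥-elim (<-asym a<b b<a)
... | yes a<b | no b≮a  = trans (dec-false (b <? a) b≮a) (cong not (sym (dec-true (a <? b) a<b)))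
... | no a≮b  | yes b<a = trans (dec-true (b <? a) b<a) (cong not (sym (dec-false (a <? b) a≮b)))
... | no a≮b  | no b≮a  = ⊥-elim (a≢b (≤-antisym (≮⇒≥ b≮a) (≮⇒≥ a≮b)))

not-xor-not : ∀ a b → not a xor not b ≡ a xor b
not-xor-not false b = not-involutive b
not-xor-not true  b = refl

Tournament : (Fin n → Fin n → Bool) → Set
Tournament g = (∀ p → g p p ≡ false) × (∀ {p q} → p ≢ q → g q p ≡ not (g p q))

lt-tournament : (f : Fin n → Fin n) → (∀ {p q} → f p ≡ f q → p ≡ q) →
  Tournament (λ p q → lt (f p) (f q))
lt-tournament f f-inj = (λ p → lt-irrefl (f p)) , (λ p≢q → lt-flip (λ e → p≢q (f-inj e)))

-- For a symmetric weight f, the sum of f over the arcs of a tournament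
-- does not depend on the tournament: the two sums differ by the sum of the
-- symmetric, zero-diagonal matrix f ∧ (g xor g′).
tournament-invariance : (f g g′ : Fin n → Fin n → Bool) → Symmetric f →
  Tournament g → Tournament g′ →
  ∑∑ (λ p q → f p q ∧ g p q) ≡ ∑∑ (λ p q → f p q ∧ g′ p q)
tournament-invariance f g g′ sym-f (g-irr , g-flip) (g′-irr , g′-flip) =
  xor-cancel (trans (sym (∑∑-xor (λ p q → f p q ∧ g p q) (λ p q → f p q ∧ g′ p q)))
                    (trans (∑∑-cong (λ p q → sym (∧-distribˡ-xor (f p q) (g p q) (g′ p q))))
                           (∑∑-symmetric _ weight-sym weight-diag)))
  where
  xor-cancel : ∀ {a b} → a xor b ≡ false → a ≡ b
  xor-cancel {false} {false} _ = refl
  xor-cancel {true}  {true}  _ = refl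

  weight-diag : ∀ p → f p p ∧ (g p p xor g′ p p) ≡ false
  weight-diag p rewrite g-irr p | g′-irr p = ∧-zeroʳ (f p p)

  weight-sym : Symmetric (λ p q → f p q ∧ (g p q xor g′ p q))
  weight-sym p q with p ≟ q
  ... | yes refl = refl
  ... | no p≢q rewrite g-flip p≢q | g′-flip p≢q =
    cong₂ _∧_ (sym-f p q) (sym (not-xor-not (g p q) (g′ p q)))

parity : Permutation′ n → Bool
parity σ = ∑∑ (λ p q → lt p q ∧ lt (σ ⟨$⟩ʳ q) (σ ⟨$⟩ʳ p))

disorder : (Fin n → Fin n) → Fin n → Fin n → Bool
disorder f p q = lt p q xor lt (f p) (f q)

perm-injective : (σ : Permutation′ n) {p q : Fin n} → σ ⟨$⟩ʳ p ≡ σ ⟨$⟩ʳ q → p ≡ q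
perm-injective σ {p} {q} eq = trans (sym (inverseˡ σ)) (trans (cong (σ ⟨$⟩ˡ_) eq) (inverseˡ σ))

inversion-disorder : (σ : Permutation′ n) (p q : Fin n) →
  lt p q ∧ lt (σ ⟨$⟩ʳ q) (σ ⟨$⟩ʳ p) ≡ lt p q ∧ disorder (σ ⟨$⟩ʳ_) p q
inversion-disorder σ p q with p ≟ q
... | yes refl rewrite lt-irrefl p = refl
... | no p≢q rewrite lt-flip (λ e → p≢q (perm-injective σ e)) = ∧-not (lt p q) _
  where
  ∧-not : ∀ a c → a ∧ not c ≡ a ∧ (a xor c)
  ∧-not false c = refl
  ∧-not true  c = refl

disorder-symmetric : (σ : Permutation′ n) → Symmetric (disorder (σ ⟨$⟩ʳ_))
disorder-symmetric σ p q with p ≟ q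
... | yes refl = refl
... | no p≢q rewrite lt-flip p≢q | lt-flip (λ e → p≢q (perm-injective σ e)) =
  sym (not-xor-not (lt p q) _)

disorder-∘ : (π σ : Permutation′ n) (p q : Fin n) →
  disorder ((π ∘ₚ σ) ⟨$⟩ʳ_) p q ≡ disorder (π ⟨$⟩ʳ_) p q xor disorder (σ ⟨$⟩ʳ_) (π ⟨$⟩ʳ p) (π ⟨$⟩ʳ q)
disorder-∘ π σ p q = telescope (lt p q) (lt (π ⟨$⟩ʳ p) (π ⟨$⟩ʳ q)) _
  where
  telescope : ∀ a b c → a xor c ≡ (a xor b) xor (b xor c)
  telescope a b c = sym (begin
      (a xor b) xor (b xor c) ≡⟨ xor-assoc a b (b xor c) ⟩
      a xor (b xor (b xor c)) ≡⟨ cong (a xor_) (sym (xor-assoc b b c)) ⟩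
      a xor ((b xor b) xor c) ≡⟨ cong (λ d → a xor (d xor c)) (xor-same b) ⟩
      a xor c                 ∎)
    where open ≡-Reasoning

-- The disorder of σ, summed over
-- the tournament p < q, gives parity σ; summed over the tournament
-- p^π < q^π it gives the same (tournament invariance), which after
-- reindexing by π is the contribution of σ to the parity of π ∘ σ.
parity-∘ : (π σ : Permutation′ n) → parity (π ∘ₚ σ) ≡ parity π xor parity σ
parity-∘ {n} π σ = begin
    parity (π ∘ₚ σ)
  ≡⟨ ∑∑-cong (inversion-disorder (π ∘ₚ σ)) ⟩
    ∑∑ (λ p q → lt p q ∧ disorder ((π ∘ₚ σ) ⟨$⟩ʳ_) p q)
  ≡⟨ ∑∑-cong (λ p q → trans (cong (lt p q ∧_) (disorder-∘ π σ p q))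
                            (∧-distribˡ-xor (lt p q) _ _)) ⟩
    ∑∑ (λ p q → lt p q ∧ disorder π′ p q xor lt p q ∧ disorder σ′ (π′ p) (π′ q))
  ≡⟨ ∑∑-xor (λ p q → lt p q ∧ disorder π′ p q) (λ p q → lt p q ∧ disorder σ′ (π′ p) (π′ q)) ⟩
    ∑∑ (λ p q → lt p q ∧ disorder π′ p q) xor ∑∑ (λ p q → lt p q ∧ disorder σ′ (π′ p) (π′ q))
  ≡⟨ cong₂ _xor_ (sym (∑∑-cong (inversion-disorder π))) σ-part ⟩
    parity π xor parity σ
  ∎
  where
  open ≡-Reasoning
  π′ σ′ : Fin n → Fin n
  π′ = π ⟨$⟩ʳ_
  σ′ = σ ⟨$⟩ʳ_
  σ-part : ∑∑ (λ p q → lt p q ∧ disorder σ′ (π′ p) (π′ q)) ≡ parity σ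
  σ-part = begin
      ∑∑ (λ p q → lt p q ∧ disorder σ′ (π′ p) (π′ q))
    ≡⟨ ∑∑-cong (λ p q → ∧-comm (lt p q) (disorder σ′ (π′ p) (π′ q))) ⟩
      ∑∑ (λ p q → disorder σ′ (π′ p) (π′ q) ∧ lt p q)
    ≡⟨ tournament-invariance (λ p q → disorder σ′ (π′ p) (π′ q)) lt (λ p q → lt (π′ p) (π′ q))
         (λ p q → disorder-symmetric σ (π′ p) (π′ q))
         (lt-tournament (λ p → p) (λ e → e)) (lt-tournament π′ (perm-injective π)) ⟩
      ∑∑ (λ p q → disorder σ′ (π′ p) (π′ q) ∧ lt (π′ p) (π′ q))
    ≡⟨ sym (∑∑-permute (λ p q → disorder σ′ p q ∧ lt p q) π) ⟩
      ∑∑ (λ p q → disorder σ′ p q ∧ lt p q)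
    ≡⟨ ∑∑-cong (λ p q → trans (∧-comm _ (lt p q)) (sym (inversion-disorder σ p q))) ⟩
      parity σ
    ∎

parity-cong : (π ρ : Permutation′ n) → (∀ x → π ⟨$⟩ʳ x ≡ ρ ⟨$⟩ʳ x) → parity π ≡ parity ρ
parity-cong π ρ π≗ρ = ∑∑-cong (λ p q → cong₂ (λ a b → lt p q ∧ lt a b) (π≗ρ q) (π≗ρ p))

parity-lift₀ : (π : Permutation′ n) → parity (lift₀ π) ≡ parity π
parity-lift₀ {n} π = cong (_xor parity π) (sum-replicate-zero n)

insert-at : ∀ {m} (i j : Fin (suc m)) (π : Permutation′ m) → insert i j π ⟨$⟩ʳ i ≡ j
insert-at i j π with i ≟ i
... | yes _   = refl
... | no i≢i = ⊥-elim (i≢i refl)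

insert-factorisation : ∀ {m} (i j : Fin (suc m)) (π : Permutation′ m) (x : Fin (suc m)) →
  insert i j π ⟨$⟩ʳ x ≡ (insert i zero id ∘ₚ (lift₀ π ∘ₚ insert zero j id)) ⟨$⟩ʳ x
insert-factorisation i j π x with x ≟ i
... | yes refl = trans (insert-at i j π)
                   (sym (trans (cong (λ y → insert zero j id ⟨$⟩ʳ (lift₀ π ⟨$⟩ʳ y)) (insert-at i zero id))
                               (insert-at zero j id)))
... | no x≢i = begin
    insert i j π ⟨$⟩ʳ x
  ≡⟨ cong (insert i j π ⟨$⟩ʳ_) (sym (punchIn-punchOut i≢x)) ⟩
    insert i j π ⟨$⟩ʳ punchIn i k
  ≡⟨ insert-punchIn i j π k ⟩
    punchIn j (π ⟨$⟩ʳ k)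
  ≡⟨ sym (insert-punchIn zero j id (π ⟨$⟩ʳ k)) ⟩
    insert zero j id ⟨$⟩ʳ (lift₀ π ⟨$⟩ʳ suc k)
  ≡⟨ cong (λ y → insert zero j id ⟨$⟩ʳ (lift₀ π ⟨$⟩ʳ y)) (sym (insert-punchIn i zero id k)) ⟩
    insert zero j id ⟨$⟩ʳ (lift₀ π ⟨$⟩ʳ (insert i zero id ⟨$⟩ʳ punchIn i k))
  ≡⟨ cong (λ y → insert zero j id ⟨$⟩ʳ (lift₀ π ⟨$⟩ʳ (insert i zero id ⟨$⟩ʳ y))) (punchIn-punchOut i≢x) ⟩
    insert zero j id ⟨$⟩ʳ (lift₀ π ⟨$⟩ʳ (insert i zero id ⟨$⟩ʳ x))
  ∎
  where
  open ≡-Reasoning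
  i≢x = λ e → x≢i (sym e)
  k = punchOut i≢x

insertion-shift : ∀ {m} → Fin (suc m) → Fin (suc m) → Bool
insertion-shift {m} i j = parity (insert {m} i zero id) xor parity (insert {m} zero j id)

parity-insert : ∀ {m} (i j : Fin (suc m)) (π : Permutation′ m) →
  parity (insert i j π) ≡ parity π xor insertion-shift i j
parity-insert i j π = begin
    parity (insert i j π)
  ≡⟨ parity-cong (insert i j π) (insert i zero id ∘ₚ (lift₀ π ∘ₚ insert zero j id)) (insert-factorisation i j π) ⟩
    parity (insert i zero id ∘ₚ (lift₀ π ∘ₚ insert zero j id))
  ≡⟨ parity-∘ (insert i zero id) (lift₀ π ∘ₚ insert zero j id) ⟩
    a xor parity (lift₀ π ∘ₚ insert zero j id)
  ≡⟨ cong (a xor_) (trans (parity-∘ (lift₀ π) (insert zero j id)) (cong (_xor b) (parity-lift₀ π))) ⟩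
    a xor (parity π xor b)
  ≡⟨ sym (xor-assoc a (parity π) b) ⟩
    (a xor parity π) xor b
  ≡⟨ cong (_xor b) (xor-comm a (parity π)) ⟩
    (parity π xor a) xor b
  ≡⟨ xor-assoc (parity π) a b ⟩
    parity π xor insertion-shift i j
  ∎
  where
  open ≡-Reasoning
  a = parity (insert i zero id)
  b = parity (insert zero j id)

oddᵇ : ℕ → Bool
oddᵇ zero    = false
oddᵇ (suc k) = not (oddᵇ k)

xorList : {A : Set} → (A → Bool) → List A → Bool
xorList h = foldr (λ a r → h a xor r) false

oddᵇ-filter : {A : Set} {P : Pred A 0ℓ} (P? : Decidable P) (xs : List A) →
  oddᵇ (length (filter P? xs)) ≡ xorList (λ a → does (P? a)) xs
oddᵇ-filter P? [] = refl
oddᵇ-filter P? (a ∷ xs) with does (P? a)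
... | true  = cong not (oddᵇ-filter P? xs)
... | false = oddᵇ-filter P? xs

xorList-++ : {A : Set} (h : A → Bool) (xs ys : List A) →
  xorList h (xs ++ ys) ≡ xorList h xs xor xorList h ys
xorList-++ h []       ys = refl
xorList-++ h (a ∷ xs) ys =
  trans (cong (h a xor_) (xorList-++ h xs ys)) (sym (xor-assoc (h a) (xorList h xs) (xorList h ys)))

xorList-concatMap : {A B : Set} (h : B → Bool) (g : A → List B) (xs : List A) →
  xorList h (concatMap g xs) ≡ xorList (λ a → xorList h (g a)) xs
xorList-concatMap h g []       = refl
xorList-concatMap h g (a ∷ xs) =
  trans (xorList-++ h (g a) (concatMap g xs)) (cong (xorList h (g a) xor_) (xorList-concatMap h g xs))

xorList-map : {A B : Set} (h : B → Bool) (g : A → B) (xs : List A) →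
  xorList h (map g xs) ≡ xorList (λ a → h (g a)) xs
xorList-map h g []       = refl
xorList-map h g (a ∷ xs) = cong (h (g a) xor_) (xorList-map h g xs)

xorList-tabulate : {A : Set} (h : A → Bool) (f : Fin n → A) →
  xorList h (tabulate f) ≡ sum (λ a → h (f a))
xorList-tabulate {zero}  h f = refl
xorList-tabulate {suc n} h f = cong (h (f zero) xor_) (xorList-tabulate h (λ a → f (suc a)))

xorList-allFin : (h : Fin n → Bool) → xorList h (allFin n) ≡ sum h
xorList-allFin h = xorList-tabulate h (λ a → a)

oddᵇ-inversions : (σ : Permutation′ n) → oddᵇ (inversions σ) ≡ parity σ
oddᵇ-inversions {n} σ = begin
    oddᵇ (inversions σ)
  ≡⟨ oddᵇ-filter _ (pairs n) ⟩
    xorList inverted (pairs n)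
  ≡⟨ xorList-concatMap inverted (λ a → map (a ,_) (allFin n)) (allFin n) ⟩
    xorList (λ a → xorList inverted (map (a ,_) (allFin n))) (allFin n)
  ≡⟨ xorList-allFin (λ a → xorList inverted (map (a ,_) (allFin n))) ⟩
    sum (λ a → xorList inverted (map (a ,_) (allFin n)))
  ≡⟨ sum-cong-≗ (λ a → trans (xorList-map inverted (a ,_) (allFin n))
                             (xorList-allFin (λ b → inverted (a , b)))) ⟩
    parity σ
  ∎
  where
  open ≡-Reasoning
  inverted : Fin n × Fin n → Bool
  inverted (a , b) = lt a b ∧ lt (σ ⟨$⟩ʳ b) (σ ⟨$⟩ʳ a)

oddᵇ-false⇒even : (k : ℕ) → oddᵇ k ≡ false → k % 2 ≡ 0
oddᵇ-false⇒even zero          _  = refl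
oddᵇ-false⇒even (suc zero)    ()
oddᵇ-false⇒even (suc (suc k)) ev =
  trans (cong (_% 2) (+-comm 2 k)) (trans ([m+n]%n≡m%n k 2) (oddᵇ-false⇒even k (trans (sym (not-involutive (oddᵇ k))) ev)))

parity-false⇒even : (σ : Permutation′ n) → parity σ ≡ false → IsEven σ
parity-false⇒even σ p = oddᵇ-false⇒even (inversions σ) (trans (oddᵇ-inversions σ) p)

-- A cell (a , b) of the n × n board stands for the condition a^σ = b.
Cell : ℕ → Set
Cell n = Fin n × Fin n

Avoids : ∀ {n} → Permutation′ n → List (Cell n) → Set
Avoids σ S = All (λ c → σ ⟨$⟩ʳ proj₁ c ≢ proj₂ c) S

Avoidable : ℕ → Set
Avoidable m = (S : List (Cell m)) → length S < m → (b : Bool) → ∃[ σ ] (parity σ ≡ b × Avoids σ S)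

-- A list of fewer than m cells leaves some row of the m × m board empty,
-- since otherwise the choice of a cell in each row would be injective.
free-row : ∀ {m} (S : List (Cell m)) → length S < m → ∃[ i ] All (λ c → proj₁ c ≢ i) S
free-row S short with all? (λ i → Any.any? (λ c → proj₁ c ≟ i) S)
... | yes occupied = ⊥-elim (<⇒notInjective short index-injective)
  where
  index-injective : ∀ {i i′} → Any.index (occupied i) ≡ Any.index (occupied i′) → i ≡ i′
  index-injective {i} {i′} eq =
    trans (sym (AnyP.lookup-index (occupied i)))
          (trans (cong (λ z → proj₁ (lookup S z)) eq) (AnyP.lookup-index (occupied i′)))
... | no ¬occupied with ¬∀⟶∃¬ _ _ (λ i → Any.any? (λ c → proj₁ c ≟ i) S) ¬occupied
...   | i , empty = i , ¬Any⇒All¬ S empty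

minor : ∀ {m} → Fin (suc m) → Fin (suc m) → List (Cell (suc m)) → List (Cell m)
minor i j [] = []
minor i j ((a , b) ∷ S) with a ≟ i | b ≟ j
... | yes _  | _      = minor i j S
... | no _   | yes _  = minor i j S
... | no a≢i | no b≢j = (punchOut (≢-sym a≢i) , punchOut (≢-sym b≢j)) ∷ minor i j S

Crosses : ∀ {n} → Fin n → Fin n → Cell n → Set
Crosses i j c = proj₁ c ≡ i ⊎ proj₂ c ≡ j

minor-deletes : ∀ {m} (i j : Fin (suc m)) c S → Crosses i j c → minor i j (c ∷ S) ≡ minor i j S
minor-deletes i j (a , b) S crosses with a ≟ i | b ≟ j
... | yes _  | _      = refl
... | no _   | yes _  = refl
... | no a≢i | no b≢j with crosses
...   | inj₁ a≡i = ⊥-elim (a≢i a≡i)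
...   | inj₂ b≡j = ⊥-elim (b≢j b≡j)

minor-cons-≤ : ∀ {m} (i j : Fin (suc m)) c S → length (minor i j (c ∷ S)) ≤ suc (length (minor i j S))
minor-cons-≤ i j (a , b) S with a ≟ i | b ≟ j
... | yes _ | _     = n≤1+n _
... | no _  | yes _ = n≤1+n _
... | no _  | no _  = ≤-refl

minor-≤ : ∀ {m} (i j : Fin (suc m)) S → length (minor i j S) ≤ length S
minor-≤ i j []      = z≤n
minor-≤ i j (c ∷ S) = ≤-trans (minor-cons-≤ i j c S) (s≤s (minor-≤ i j S))

minor-tabulate-≤ : ∀ {n m} (i j : Fin (suc m)) (c : Fin n → Cell (suc m)) →
  length (minor i j (tabulate c)) ≤ n
minor-tabulate-≤ i j c = ≤-trans (minor-≤ i j (tabulate c)) (≤-reflexive (length-tabulate c))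

minor-drops-one : ∀ {n m} (i j : Fin (suc m)) (c : Fin n → Cell (suc m)) (t : Fin n) →
  Crosses i j (c t) → suc (length (minor i j (tabulate c))) ≤ n
minor-drops-one i j c zero crosses
  rewrite minor-deletes i j (c zero) (tabulate (λ t → c (suc t))) crosses =
  s≤s (minor-tabulate-≤ i j (λ t → c (suc t)))
minor-drops-one {suc n} i j c (suc t) crosses =
  ≤-trans (s≤s (minor-cons-≤ i j (c zero) (tabulate (λ t → c (suc t)))))
          (s≤s (minor-drops-one i j (λ t → c (suc t)) t crosses))

minor-drops-two : ∀ {n m} (i j : Fin (suc m)) (c : Fin n → Cell (suc m)) (t₁ t₂ : Fin n) → t₁ ≢ t₂ →
  Crosses i j (c t₁) → Crosses i j (c t₂) → suc (suc (length (minor i j (tabulate c)))) ≤ n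
minor-drops-two i j c zero zero t₁≢t₂ _ _ = ⊥-elim (t₁≢t₂ refl)
minor-drops-two i j c zero (suc t₂) _ crosses₁ crosses₂
  rewrite minor-deletes i j (c zero) (tabulate (λ t → c (suc t))) crosses₁ =
  s≤s (minor-drops-one i j (λ t → c (suc t)) t₂ crosses₂)
minor-drops-two i j c (suc t₁) zero _ crosses₁ crosses₂
  rewrite minor-deletes i j (c zero) (tabulate (λ t → c (suc t))) crosses₂ =
  s≤s (minor-drops-one i j (λ t → c (suc t)) t₁ crosses₁)
minor-drops-two {suc n} i j c (suc t₁) (suc t₂) t₁≢t₂ crosses₁ crosses₂ =
  ≤-trans (s≤s (s≤s (minor-cons-≤ i j (c zero) (tabulate (λ t → c (suc t))))))
          (s≤s (minor-drops-two i j (λ t → c (suc t)) t₁ t₂ (λ e → t₁≢t₂ (cong suc e)) crosses₁ crosses₂))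

insert-off : ∀ {m} (i j : Fin (suc m)) (π : Permutation′ m) {a : Fin (suc m)} (a≢i : a ≢ i) →
  insert i j π ⟨$⟩ʳ a ≡ punchIn j (π ⟨$⟩ʳ punchOut (≢-sym a≢i))
insert-off i j π a≢i =
  trans (cong (insert i j π ⟨$⟩ʳ_) (sym (punchIn-punchOut (≢-sym a≢i)))) (insert-punchIn i j π _)

-- If (i , j) is not in S and π avoids the minor of S at (i , j), then
-- insert i j π avoids S: cells in row i or column j are avoided because
-- i ↦ j, the others because π avoids their renumbered copies.
insert-avoids : ∀ {m} (i j : Fin (suc m)) (π : Permutation′ m) (S : List (Cell (suc m))) →
  All (_≢ (i , j)) S → Avoids π (minor i j S) → Avoids (insert i j π) S
insert-avoids i j π [] _ _ = []
insert-avoids i j π ((a , b) ∷ S) (ab≢ij ∷ S∌ij) avoids with a ≟ i | b ≟ j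
... | yes refl | _ =
  (λ a↦b → ab≢ij (cong (a ,_) (trans (sym a↦b) (insert-at a j π)))) ∷ insert-avoids i j π S S∌ij avoids
... | no a≢i | yes refl =
  (λ a↦b → punchInᵢ≢i b _ (trans (sym (insert-off i b π a≢i)) a↦b)) ∷ insert-avoids i j π S S∌ij avoids
... | no a≢i | no b≢j with avoids
...   | π-avoids ∷ avoids′ =
  (λ a↦b → π-avoids (punchIn-injective j _ _
     (trans (sym (insert-off i j π a≢i)) (trans a↦b (sym (punchIn-punchOut (≢-sym b≢j)))))))
  ∷ insert-avoids i j π S S∌ij avoids′

-- The insertion argument: if (i , j) is not in S and the minor of S at
-- (i , j) is short enough to be avoided, then S is avoided with either
-- parity, by insert i j π for π of the corrected parity.
avoid-by-insertion : ∀ {m} → Avoidable m → (i j : Fin (suc m)) (S : List (Cell (suc m))) →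
  All (_≢ (i , j)) S → length (minor i j S) < m →
  (b : Bool) → ∃[ σ ] (parity σ ≡ b × Avoids σ S)
avoid-by-insertion avoidable i j S S∌ij short b
  with avoidable (minor i j S) short (b xor insertion-shift i j)
... | π , parity-π , π-avoids = insert i j π , parity-σ , insert-avoids i j π S S∌ij π-avoids
  where
  open ≡-Reasoning
  s = insertion-shift i j
  parity-σ : parity (insert i j π) ≡ b
  parity-σ = begin
      parity (insert i j π) ≡⟨ parity-insert i j π ⟩
      parity π xor s        ≡⟨ cong (_xor s) parity-π ⟩
      (b xor s) xor s       ≡⟨ xor-assoc b s s ⟩
      b xor (s xor s)       ≡⟨ cong (b xor_) (xor-same s) ⟩
      b xor false           ≡⟨ xor-identityʳ b ⟩
      b                     ∎

-- Induction step: place a free row i against the column of the first cell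
-- of S; that cell disappears in the minor.
avoidable-step : ∀ {m} → 1 ≤ m → Avoidable m → Avoidable (suc m)
avoidable-step {m} m≥1 avoidable S short with free-row S short
... | i , row-i-free =
  avoid-by-insertion avoidable i (first-column S) S
    (All.map (λ a≢i ab≡ij → a≢i (cong proj₁ ab≡ij)) row-i-free) (minor-short S short)
  where
  first-column : List (Cell (suc m)) → Fin (suc m)
  first-column []            = zero
  first-column ((_ , b) ∷ _) = b

  minor-short : ∀ S → length S < suc m → length (minor i (first-column S) S) < m
  minor-short []            _             = m≥1
  minor-short ((a , b) ∷ S) (s≤s S<m)
    rewrite minor-deletes i b (a , b) S (inj₂ refl) = ≤-trans (s≤s (minor-≤ i b S)) S<m

S₃ : Bool → Fin 3 → Permutation′ 3
S₃ false zero             = id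
S₃ false (suc zero)       = transpose zero (suc zero) ∘ₚ transpose (suc zero) (suc (suc zero))
S₃ false (suc (suc zero)) = transpose (suc zero) (suc (suc zero)) ∘ₚ transpose zero (suc zero)
S₃ true  zero             = transpose zero (suc zero)
S₃ true  (suc zero)       = transpose zero (suc (suc zero))
S₃ true  (suc (suc zero)) = transpose (suc zero) (suc (suc zero))

S₃-parity : ∀ b t → parity (S₃ b t) ≡ b
S₃-parity false zero             = refl
S₃-parity false (suc zero)       = refl
S₃-parity false (suc (suc zero)) = refl
S₃-parity true  zero             = refl
S₃-parity true  (suc zero)       = refl
S₃-parity true  (suc (suc zero)) = refl

AvoidsTwo : Bool → Set
AvoidsTwo b = ∀ a₁ b₁ a₂ b₂ → ∃[ t ] (S₃ b t ⟨$⟩ʳ a₁ ≢ b₁ × S₃ b t ⟨$⟩ʳ a₂ ≢ b₂)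

avoids-two? : ∀ b → Dec (AvoidsTwo b)
avoids-two? b = all? λ a₁ → all? λ b₁ → all? λ a₂ → all? λ b₂ → any? λ t →
  ¬? (S₃ b t ⟨$⟩ʳ a₁ ≟ b₁) ×-dec ¬? (S₃ b t ⟨$⟩ʳ a₂ ≟ b₂)

avoids-two : ∀ b → AvoidsTwo b
avoids-two false = toWitness {a? = avoids-two? false} tt
avoids-two true  = toWitness {a? = avoids-two? true} tt

avoidable-3 : Avoidable 3
avoidable-3 [] _ b = S₃ b zero , S₃-parity b zero , []
avoidable-3 ((a , c) ∷ []) _ b with avoids-two b a c a c
... | t , avoids , _ = S₃ b t , S₃-parity b t , avoids ∷ []
avoidable-3 ((a₁ , c₁) ∷ (a₂ , c₂) ∷ []) _ b with avoids-two b a₁ c₁ a₂ c₂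
... | t , avoids₁ , avoids₂ = S₃ b t , S₃-parity b t , avoids₁ ∷ avoids₂ ∷ []
avoidable-3 (_ ∷ _ ∷ _ ∷ _) (s≤s (s≤s (s≤s ())))

avoidable : ∀ k → Avoidable (3 + k)
avoidable zero    = avoidable-3
avoidable (suc k) = avoidable-step (s≤s z≤n) (avoidable k)


Member : ∀ {n} (u v : Fin n → Fin n) → Fin n → Fin n → Set
Member u v i j = ∃[ s ] (u s ≡ i × v s ≡ j)

member? : ∀ {n} (u v : Fin n → Fin n) i j → Dec (Member u v i j)
member? u v i j = any? (λ s → (u s ≟ i) ×-dec (v s ≟ j))

Sparse : ∀ {n} (u v : Fin n → Fin n) → Set
Sparse u v = ∀ i j → ¬ Member u v i j →
  ∀ t₁ t₂ → Crosses i j (u t₁ , v t₁) → Crosses i j (u t₂ , v t₂) → t₁ ≡ t₂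

sparse-transpose : ∀ {n} {u v : Fin n → Fin n} → Sparse u v → Sparse v u
sparse-transpose sparse j i ¬member t₁ t₂ crosses₁ crosses₂ =
  sparse i j (λ { (s , e₁ , e₂) → ¬member (s , e₂ , e₁) }) t₁ t₂ (Sum.swap crosses₁) (Sum.swap crosses₂)

Clash : ∀ {n} (u v : Fin n → Fin n) → Set
Clash u v = ∃[ i ] ∃[ j ] ∃[ t₁ ] ∃[ t₂ ]
  (¬ Member u v i j × t₁ ≢ t₂ × Crosses i j (u t₁ , v t₁) × Crosses i j (u t₂ , v t₂))

clash? : ∀ {n} (u v : Fin n → Fin n) → Dec (Clash u v)
clash? u v = any? λ i → any? λ j → any? λ t₁ → any? λ t₂ →
  ¬? (member? u v i j) ×-dec ¬? (t₁ ≟ t₂) ×-dec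
  ((u t₁ ≟ i) ⊎-dec (v t₁ ≟ j)) ×-dec ((u t₂ ≟ i) ⊎-dec (v t₂ ≟ j))

sparse-or-clash : ∀ {n} (u v : Fin n → Fin n) → Sparse u v ⊎ Clash u v
sparse-or-clash u v with clash? u v
... | yes clash = inj₂ clash
... | no ¬clash = inj₁ sparse
  where
  sparse : Sparse u v
  sparse i j ¬member t₁ t₂ crosses₁ crosses₂ with t₁ ≟ t₂
  ... | yes t₁≡t₂ = t₁≡t₂
  ... | no t₁≢t₂  = ⊥-elim (¬clash (i , j , t₁ , t₂ , ¬member , t₁≢t₂ , crosses₁ , crosses₂))

IsRow : ∀ {n} (u v : Fin n → Fin n) → Fin n → Set
IsRow u v i = (∀ s → u s ≡ i) × (∀ j → Member u v i j)

-- In a sparse family, two members sharing a row force the whole family to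
-- be that row: every cell of the row is a member (otherwise its row would
-- meet two members), and these n members exhaust the family.
sparse-row : ∀ {n} (u v : Fin n → Fin n) → Sparse u v →
  ∀ {z t} → t ≢ z → u t ≡ u z → IsRow u v (u z)
sparse-row {n} u v sparse {z} {t} t≢z same-row = all-in-row , all-columns
  where
  all-columns : ∀ j → Member u v (u z) j
  all-columns j with member? u v (u z) j
  ... | yes member = member
  ... | no ¬member = ⊥-elim (t≢z (sparse (u z) j ¬member t z (inj₁ same-row) (inj₁ refl)))

  all-in-row : ∀ s → u s ≡ u z
  all-in-row s with u s ≟ u z
  ... | yes in-row = in-row
  ... | no ¬in-row = ⊥-elim (<⇒notInjective (n<1+n n) injective)
    where
    -- s together with the members found in each column: n + 1 distinct members
    pick : Fin (suc n) → Fin n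
    pick zero    = s
    pick (suc j) = proj₁ (all-columns j)

    injective : ∀ {a b} → pick a ≡ pick b → a ≡ b
    injective {zero}  {zero}  _  = refl
    injective {zero}  {suc j} eq = ⊥-elim (¬in-row (trans (cong u eq) (proj₁ (proj₂ (all-columns j)))))
    injective {suc j} {zero}  eq = ⊥-elim (¬in-row (trans (cong u (sym eq)) (proj₁ (proj₂ (all-columns j)))))
    injective {suc j} {suc j′} eq =
      cong suc (trans (sym (proj₂ (proj₂ (all-columns j)))) (trans (cong v eq) (proj₂ (proj₂ (all-columns j′)))))

-- A sparse family of n ≥ 2 cells is a full row or a full column: look at
-- the cell in the row of member 0 and the column of member 1.
sparse-line : ∀ {n} (u v : Fin (suc (suc n)) → Fin (suc (suc n))) → Sparse u v →
  (∃[ i ] IsRow u v i) ⊎ (∃[ j ] IsRow v u j)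
sparse-line u v sparse with any? (λ t → ¬? (t ≟ zero) ×-dec (u t ≟ u zero))
... | yes (t , t≢0 , same-row) = inj₁ (u zero , sparse-row u v sparse t≢0 same-row)
... | no no-row-mate with any? (λ t → ¬? (t ≟ zero) ×-dec (v t ≟ v zero))
...   | yes (t , t≢0 , same-col) = inj₂ (v zero , sparse-row v u (sparse-transpose sparse) t≢0 same-col)
...   | no no-col-mate with member? u v (u zero) (v (suc zero))
...     | no ¬member = ⊥-elim (0≢1+n (sparse (u zero) (v (suc zero)) ¬member zero (suc zero) (inj₁ refl) (inj₂ refl)))
...     | yes (s , row-0 , col-1) with s ≟ zero
...       | yes refl = ⊥-elim (no-col-mate (suc zero , (λ ()) , sym col-1))
...       | no s≢0   = ⊥-elim (no-row-mate (s , s≢0 , row-0))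

filter-allFin-< : ∀ {n} {P : Pred (Fin n) 0ℓ} (P? : Decidable P) {t} → ¬ P t →
  length (filter P? (allFin n)) < n
filter-allFin-< {n} P? {t} ¬Pt =
  ≤-trans (filter-notAll P? (allFin n) (AnyP.tabulate⁺ {f = λ s → s} t ¬Pt))
          (≤-reflexive (length-tabulate (λ s → s)))

-- Lines cover: for g ∈ A_n^q, the point i^{σ_k} (resp. the preimage of j)
-- selects a member of 𝓡_i^{(k)} (resp. 𝓒_j^{(k)}) containing g.
line⇒covers : ∀ {n q} (x : Fin n → Pred (AltPow n q) 0ℓ) →
  (∃[ k ] ((∃[ i ] SameFamily x (Row k i)) ⊎ (∃[ j ] SameFamily x (Col k j)))) → CoversAll x
line⇒covers x (k , inj₁ (i , _ , row⊆x)) g with row⊆x (proj₁ (g k) ⟨$⟩ʳ i)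
... | t , x≐B = t , proj₂ x≐B refl
line⇒covers x (k , inj₂ (j , _ , col⊆x)) g with col⊆x (proj₁ (g k) ⟨$⟩ˡ j)
... | t , x≐B = t , proj₂ x≐B (inverseʳ (proj₁ (g k)))

≐B-cong : ∀ {n q} {y : Pred (AltPow n q) 0ℓ} {k k′ i i′ j j′} →
  y ≐ B k i j → k ≡ k′ → i ≡ i′ → j ≡ j′ → y ≐ B k′ i′ j′
≐B-cong y≐B refl refl refl = y≐B

module Covering (r q : ℕ) (x : Fin (4 + r) → Pred (AltPow (4 + r) q) 0ℓ)
                (x∈𝓑 : (t : Fin (4 + r)) → In𝓑 (x t)) where

  N : ℕ
  N = 4 + r

  coord : Fin N → Fin q
  coord t = proj₁ (x∈𝓑 t)

  row col : Fin N → Fin N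
  row t = proj₁ (proj₂ (x∈𝓑 t))
  col t = proj₁ (proj₂ (proj₂ (x∈𝓑 t)))

  x≐B : ∀ t → x t ≐ B (coord t) (row t) (col t)
  x≐B t = proj₂ (proj₂ (proj₂ (x∈𝓑 t)))

  cell : Fin N → Cell N
  cell t = row t , col t

  not-covered : (σ : Fin q → Permutation′ N) → (∀ k → parity (σ k) ≡ false) →
    (∀ t → σ (coord t) ⟨$⟩ʳ row t ≢ col t) → ¬ CoversAll x
  not-covered σ even avoids covers with covers (λ k → σ k , parity-false⇒even (σ k) (even k))
  ... | t , g∈x = avoids t (proj₁ (x≐B t) g∈x)

  -- Members in different coordinates cannot cover: each coordinate then
  -- carries fewer than N cells, which an even permutation avoids.
  covering⇒one-coordinate : CoversAll x → ∀ t → coord t ≡ coord zero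
  covering⇒one-coordinate covers with all? (λ t → coord t ≟ coord zero)
  ... | yes same = same
  ... | no ¬same with ¬∀⟶∃¬ N _ (λ t → coord t ≟ coord zero) ¬same
  ...   | t₀ , t₀-elsewhere = ⊥-elim (not-covered σ (λ k → proj₁ (proj₂ (avoider k))) avoids covers)
    where
    cells-at : Fin q → List (Cell N)
    cells-at k = map cell (filter (λ t → coord t ≟ k) (allFin N))

    elsewhere : ∀ k → ∃[ t ] (coord t ≢ k)
    elsewhere k with coord zero ≟ k
    ... | yes refl = t₀ , t₀-elsewhere
    ... | no 0-elsewhere = zero , 0-elsewhere

    few : ∀ k → length (cells-at k) < N
    few k = ≤-trans (≤-reflexive (cong suc (length-map cell (filter (λ t → coord t ≟ k) (allFin N)))))
                    (filter-allFin-< (λ t → coord t ≟ k) (proj₂ (elsewhere k)))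

    avoider : ∀ k → ∃[ σ ] (parity σ ≡ false × Avoids σ (cells-at k))
    avoider k = avoidable (suc r) (cells-at k) (few k) false

    σ : Fin q → Permutation′ N
    σ k = proj₁ (avoider k)

    avoids : ∀ t → σ (coord t) ⟨$⟩ʳ row t ≢ col t
    avoids t = All.lookup (AllP.map⁻ (proj₂ (proj₂ (avoider (coord t)))))
                          (∈-filter⁺ (λ s → coord s ≟ coord t) (∈-allFin t) refl)

  -- A covering family is sparse: at a clash (i , j), the minor loses two
  -- cells, so the insertion argument yields one even permutation avoiding
  -- every cell, to be used in all coordinates.
  covering⇒sparse : CoversAll x → Sparse row col
  covering⇒sparse covers with sparse-or-clash row col
  ... | inj₁ sparse = sparse
  ... | inj₂ (i , j , t₁ , t₂ , ¬member , t₁≢t₂ , crosses₁ , crosses₂) =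
    ⊥-elim (not-covered (λ _ → σ) (λ _ → proj₁ (proj₂ avoider)) avoids covers)
    where
    outside : All (_≢ (i , j)) (tabulate cell)
    outside = AllP.tabulate⁺ (λ t ij → ¬member (t , cong proj₁ ij , cong proj₂ ij))

    avoider : ∃[ σ ] (parity σ ≡ false × Avoids σ (tabulate cell))
    avoider = avoid-by-insertion (avoidable r) i j (tabulate cell) outside
                (≤-pred (minor-drops-two i j cell t₁ t₂ t₁≢t₂ crosses₁ crosses₂)) false

    σ : Permutation′ N
    σ = proj₁ avoider

    avoids : ∀ t → σ ⟨$⟩ʳ row t ≢ col t
    avoids = AllP.tabulate⁻ (proj₂ (proj₂ avoider))

  row-family : ∀ {k i} → (∀ t → coord t ≡ k) → IsRow row col i → SameFamily x (Row k i)
  row-family same (in-row , all-columns) =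
    (λ t → col t , ≐B-cong (x≐B t) (same t) (in-row t) refl) ,
    (λ j → let (t , row-i , col-j) = all-columns j in t , ≐B-cong (x≐B t) (same t) row-i col-j)

  column-family : ∀ {k j} → (∀ t → coord t ≡ k) → IsRow col row j → SameFamily x (Col k j)
  column-family same (in-col , all-rows) =
    (λ t → row t , ≐B-cong (x≐B t) (same t) refl (in-col t)) ,
    (λ i → let (t , col-j , row-i) = all-rows i in t , ≐B-cong (x≐B t) (same t) row-i col-j)

  covers⇒line : CoversAll x →
    ∃[ k ] ((∃[ i ] SameFamily x (Row k i)) ⊎ (∃[ j ] SameFamily x (Col k j)))
  covers⇒line covers =
    coord zero ,
    Sum.map (λ (i , is-row) → i , row-family one-coordinate is-row)
            (λ (j , is-col) → j , column-family one-coordinate is-col)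
            (sparse-line row col (covering⇒sparse covers))
    where
    one-coordinate : ∀ t → coord t ≡ coord zero
    one-coordinate = covering⇒one-coordinate covers

lemma4p7 : (n q : ℕ) → 5 ≤ n → 1 ≤ q →
    (x : Fin n → Pred (AltPow n q) 0ℓ) → ((t : Fin n) → In𝓑 (x t)) →
    CoversAll x ⇔ (∃[ k ] ((∃[ i ] SameFamily x (Row k i)) ⊎ (∃[ j ] SameFamily x (Col k j))))
lemma4p7 (suc (suc (suc (suc (suc r))))) q (s≤s (s≤s (s≤s (s≤s (s≤s _))))) _ x x∈𝓑 =
  mk⇔ (Covering.covers⇒line (suc r) q x x∈𝓑) (line⇒covers x)
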